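{- For every digraph $G$ the following are equivalent: (1) $G$ is a DAG; (2) $\mathrm{d\text{ - }vsn}(G)=0$; (3) $\mathrm{d\text{ - }pw}(G)=0$; (4) $\mathrm{d\text{ - }cutw}(G)=0$.
   Context: Digraphs $G=(V,E)$ are finite with $E\subseteq\{(u,v):u\ne v\}$. A DAG is a digraph containing no directed cycle (of any length $\ge2$) as a subdigraph. A layout is a bijection $\varphi:V\to\{1,\dots,|V|\}$; $L(i,\varphi)=\{u:\varphi(u)\le i\}$, $R(i,\varphi)=\{u:\varphi(u)>i\}$. $\mathrm{d\text{ - }vsn}(G)=\min_\varphi\max_i|\{u\in L(i,\varphi):\exists v\in R(i,\varphi),(v,u)\in E\}|$. $\mathrm{d\text{ - }pw}(G)$ is the minimum of $\max|X_i|-1$ over sequences $(X_1,\dots,X_r)$ of subsets of $V$ with $\bigcup X_i=V$, for each $(u,v)\in E$ some $i\le j$ with $u\in X_i,v\in X_j$, and $X_i\cap X_\ell\subseteq X_j$ for $i<j<\ell$. $\mathrm{d\text{ - }cutw}(G)=\min_\varphi\max_i|\{(u,v)\in E:u\in L(i,\varphi),v\in R(i,\varphi)\}|$. -}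

module Defs where

import Data.Nat.Properties
import Data.Fin
import Data.Product
open import Data.Nat using (ℕ; zero; suc; _≤_; _<_; _<ᵇ_)
open import Data.Fin using (Fin; toℕ; fromℕ<) renaming (zero to fzero)
open import Data.Fin.Subset using (Subset; _∈_; _⊆_; _∩_; ∣_∣)
open import Data.Bool using (Bool; true; false; _∧_; not)
open import Data.List using (List; length; filterᵇ; concatMap; map)
open import Data.Bool.ListAction using (any)
open import Data.List.Base using (allFin)
open import Data.Product using (Σ; ∃; ∃-syntax; _×_; _,_)
open import Relation.Binary.PropositionalEquality using (_≡_)
open import Relation.Nullary using (¬_)
open import Function.Bundles using (_↔_; Inverse)
open import Function.Definitions using (Injective)

record Digraph : Set where
  field
    n       : ℕ
    adj     : Fin n → Fin n → Bool
    loopless : ∀ u → adj u u ≡ false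

open Digraph public

Edge : (G : Digraph) → Fin (n G) → Fin (n G) → Set
Edge G u v = adj G u v ≡ true

-- A directed cycle of length m = suc (suc k) ≥ 2 as a subdigraph:
-- distinct vertices c 0, …, c (m-1) with edges c i → c (i+1) and c (m-1) → c 0.
record DirectedCycle (G : Digraph) : Set where
  field
    k      : ℕ
    c      : Fin (suc (suc k)) → Fin (n G)
    c-inj  : Injective _≡_ _≡_ c
    step   : ∀ i (p : suc i < suc (suc k)) →
             Edge G (c (fromℕ< (Data.Nat.Properties.<-trans (Data.Nat.Properties.n<1+n i) p))) (c (fromℕ< p))
    close  : Edge G (c (Data.Fin.fromℕ (suc k))) (c fzero)

IsDAG : Digraph → Set
IsDAG G = ¬ DirectedCycle G

-- Layouts: bijections V → {1,…,|V|}, represented 0-based as V ↔ Fin |V|.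
Layout : Digraph → Set
Layout G = Fin (n G) ↔ Fin (n G)

module _ (G : Digraph) (φ : Layout G) where
  pos : Fin (n G) → ℕ       -- 1-based position φ(u)
  pos u = suc (toℕ (Inverse.to φ u))

  inL : ℕ → Fin (n G) → Bool
  inL i u = pos u <ᵇ suc i

  inR : ℕ → Fin (n G) → Bool
  inR i u = not (inL i u)

  vsnAt : ℕ → ℕ
  vsnAt i = length (filterᵇ (λ u → inL i u ∧ any (λ v → inR i v ∧ adj G v u) (allFin (n G))) (allFin (n G)))

  cutAt : ℕ → ℕ
  cutAt i = length (filterᵇ (λ uv → inL i (Data.Product.proj₁ uv) ∧ inR i (Data.Product.proj₂ uv)
                                     ∧ adj G (Data.Product.proj₁ uv) (Data.Product.proj₂ uv))
                      (concatMap (λ u → map (λ v → (u , v)) (allFin (n G))) (allFin (n G))))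

DVsnAtMost : Digraph → ℕ → Set
DVsnAtMost G k = Σ (Layout G) λ φ → ∀ i → 1 ≤ i → i ≤ n G → vsnAt G φ i ≤ k

DVsnIs : Digraph → ℕ → Set
DVsnIs G k = DVsnAtMost G k × (∀ k′ → DVsnAtMost G k′ → k ≤ k′)

DCutwAtMost : Digraph → ℕ → Set
DCutwAtMost G k = Σ (Layout G) λ φ → ∀ i → 1 ≤ i → i ≤ n G → cutAt G φ i ≤ k

DCutwIs : Digraph → ℕ → Set
DCutwIs G k = DCutwAtMost G k × (∀ k′ → DCutwAtMost G k′ → k ≤ k′)

-- Directed path decompositions (X_1,…,X_r), indexed 0-based by Fin r.
record DirPathDecomposition (G : Digraph) : Set where
  field
    r      : ℕ
    X      : Fin r → Subset (n G)
    cover  : ∀ v → ∃[ i ] (v ∈ X i)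
    edges  : ∀ u v → Edge G u v → ∃[ i ] ∃[ j ] (toℕ i ≤ toℕ j × u ∈ X i × v ∈ X j)
    interp : ∀ i j l → toℕ i < toℕ j → toℕ j < toℕ l → (X i ∩ X l) ⊆ X j

-- width ≤ k  iff  every bag has at most k+1 vertices
DPwAtMost : Digraph → ℕ → Set
DPwAtMost G k = Σ (DirPathDecomposition G) λ D →
  ∀ i → ∣ DirPathDecomposition.X D i ∣ ≤ suc k

DPwIs : Digraph → ℕ → Set
DPwIs G k = DPwAtMost G k × (∀ k′ → DPwAtMost G k′ → k ≤ k′)

module Submission where

-- All four conditions are reduced to the existence of a layout of G in which
-- every edge points forward (an ascending, i.e. topological, layout) or, dually,
-- backward (descending).  The development proceeds as follows.
--   * A potential increasing along edges excludes directed cycles; conversely, in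
--     a graph where every vertex has an out-neighbour, following out-neighbours
--     until the first repetition closes a directed cycle.  Hence every nonempty
--     DAG has a sink, and deleting sinks one at a time yields a descending layout
--     of any DAG; reading it backwards gives an ascending one.
--   * Counting lemmas identify "vsnAt i ≤ 0" with "no edge enters L(i) from R(i)"
--     and "cutAt i ≤ 0" with "no edge leaves L(i) for R(i)".  Over all cuts these
--     say precisely that the layout is ascending, resp. descending.
--   * Singleton bags along an ascending layout form a path decomposition of width
--     0; conversely, in a width-0 decomposition the index of a bag containing a
--     vertex is a potential increasing along edges.

open import Defs
open import Data.Bool using (Bool; true; false; T; not; T?)
open import Data.Bool.Properties using (T-≡; T-∧)
import Data.Bool.Properties as Bool
open import Data.Empty using (⊥-elim)
open import Data.Fin using (Fin; toℕ; fromℕ; fromℕ<; inject; punchIn; punchOut) renaming (zero to 0F)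
import Data.Fin as Fin
open import Data.Fin.Properties using (toℕ<n; toℕ-fromℕ; toℕ-fromℕ<; fromℕ<-toℕ; toℕ-injective; toℕ-inject; any?; all?; pigeonhole; ¬∀⟶∃¬; ¬∀⟶∃¬-smallest; punchIn-injective; punchIn-punchOut; opposite-prop)
import Data.Fin.Properties as Finₚ
open import Data.Fin.Permutation using (Permutation; _∘ₚ_; reverse; insert; insert-punchIn; _⟨$⟩ʳ_)
import Data.Fin.Permutation as Permutation
open import Data.Fin.Subset using (Subset; ⁅_⁆; _∩_; ∣_∣; _-_) renaming (_∈_ to _∈ₛ_)
open import Data.Fin.Subset.Properties using (x∈⁅x⁆; x∈⁅y⁆⇒x≡y; ∣⁅x⁆∣≡1; x∈p∩q⁺; x∈p∩q⁻; p⊆q⇒∣p∣≤∣q∣; x∈p∧x≢y⇒x∈p-y; x∈p⇒∣p-x∣<∣p∣)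
open import Data.List using (List; []; _∷_; _++_; length; filterᵇ; concatMap; map; allFin; cartesianProduct)
open import Data.List.Membership.Propositional using (_∈_; lose)
open import Data.List.Membership.Propositional.Properties using (∈-allFin; ∈-cartesianProduct⁺)
open import Data.List.Properties using (filter-some; filter-none)
import Data.List.Relation.Unary.All as All
open import Data.List.Relation.Unary.Any using (satisfied)
open import Data.List.Relation.Unary.Any.Properties using (any⁺; any⁻)
open import Data.Nat using (ℕ; zero; suc; _+_; _∸_; _≤_; _<_; z≤n; s≤s; s<s⁻¹)
open import Data.Nat.Properties
open import Data.Product using (Σ; ∃; ∃₂; _×_; _,_; proj₁; proj₂)
open import Function.Base using (_∘_)
open import Function.Bundles using (Inverse; Injection; _⇔_; mk⇔; Equivalence)
open import Function.Definitions using (Injective)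
open import Function.Properties.Inverse using (↔⇒↣)
open import Relation.Binary.Definitions using (tri<; tri≈; tri>)
open import Relation.Binary.PropositionalEquality
open import Relation.Nullary using (¬_; yes; no; Dec; contradiction)
open import Relation.Nullary.Decidable using (¬?; decidable-stable)

open Equivalence using (to; from)

noLoop : (G : Digraph) → ∀ u → ¬ Edge G u u
noLoop G u e with trans (sym e) (loopless G u)
... | ()

-- A potential that strictly increases along every edge rules out directed
-- cycles: walking once around a cycle it would return to its starting value.
potential⇒acyclic : (G : Digraph) (f : Fin (n G) → ℕ) →
                    (∀ u v → Edge G u v → f u < f v) → IsDAG G
potential⇒acyclic G f increasing C =
  <-irrefl refl (<-≤-trans (increasing _ _ close) (aboveStart (fromℕ (suc k))))
  where
  open DirectedCycle C
  alongCycle : ∀ t (t<len : t < suc (suc k)) → f (c 0F) ≤ f (c (fromℕ< t<len))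
  alongCycle zero    _     = ≤-refl
  alongCycle (suc t) t<len =
    ≤-trans (alongCycle t (<-trans (n<1+n t) t<len)) (<⇒≤ (increasing _ _ (step t t<len)))
  aboveStart : ∀ i → f (c 0F) ≤ f (c i)
  aboveStart i = subst (λ j → f (c 0F) ≤ f (c j)) (fromℕ<-toℕ i (toℕ<n i))
                       (alongCycle (toℕ i) (toℕ<n i))

closedWalk⇒cycle : (G : Digraph) (w : ℕ → Fin (n G)) (d : ℕ) →
                   (∀ t → Edge G (w t) (w (suc t))) → w d ≡ w 0 → 1 ≤ d →
                   (∀ a b → a < b → b < d → w a ≢ w b) → DirectedCycle G
closedWalk⇒cycle G w (suc zero) walk closed _ _ =
  ⊥-elim (noLoop G (w 0) (subst (Edge G (w 0)) closed (walk 0)))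
closedWalk⇒cycle G w (suc (suc k)) walk closed _ distinct = record
  { k = k ; c = c ; c-inj = c-injective ; step = step ; close = close }
  where
  c : Fin (suc (suc k)) → Fin (n G)
  c i = w (toℕ i)
  c-injective : Injective _≡_ _≡_ c
  c-injective {a} {b} eq with <-cmp (toℕ a) (toℕ b)
  ... | tri< a<b _ _ = contradiction eq (distinct _ _ a<b (toℕ<n b))
  ... | tri≈ _ a≡b _ = toℕ-injective a≡b
  ... | tri> _ _ b<a = contradiction (sym eq) (distinct _ _ b<a (toℕ<n a))
  step : ∀ t (p : suc t < suc (suc k)) →
         Edge G (c (fromℕ< (<-trans (n<1+n t) p))) (c (fromℕ< p))
  step t p = subst₂ (λ a b → Edge G (w a) (w b))
                    (sym (toℕ-fromℕ< (<-trans (n<1+n t) p))) (sym (toℕ-fromℕ< p)) (walk t)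
  close : Edge G (c (fromℕ (suc k))) (c 0F)
  close = subst₂ (λ a b → Edge G (w a) b) (sym (toℕ-fromℕ (suc k))) closed (walk (suc k))

module FirstRepetition {m} (w : ℕ → Fin m) where

  Fresh : Fin (suc m) → Set
  Fresh j = ∀ (a : Fin (toℕ j)) → w (toℕ a) ≢ w (toℕ j)

  fresh? : ∀ j → Dec (Fresh j)
  fresh? j = all? λ a → ¬? (w (toℕ a) Fin.≟ w (toℕ j))

  freshBelow : ∀ j → Fresh j → ∀ a → a < toℕ j → w a ≢ w (toℕ j)
  freshBelow j fresh a a<j =
    subst (λ t → w t ≢ w (toℕ j)) (toℕ-fromℕ< a<j) (fresh (fromℕ< a<j))

  notAllFresh : ¬ (∀ j → Fresh j)
  notAllFresh allFresh with pigeonhole (n<1+n m) (w ∘ toℕ)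
  ... | i , j , i<j , eq = freshBelow j (allFresh j) (toℕ i) i<j eq

  firstRepetition : ∃₂ λ i j → i < j × w i ≡ w j × (∀ a b → a < b → b < j → w a ≢ w b)
  firstRepetition with ¬∀⟶∃¬-smallest (suc m) Fresh fresh? notAllFresh
  ... | j , notFresh , earlierFresh with ¬∀⟶∃¬ (toℕ j) _ (λ a → ¬? (w (toℕ a) Fin.≟ w (toℕ j))) notFresh
  ...   | i , notDistinct =
    toℕ i , toℕ j , toℕ<n i , decidable-stable (w (toℕ i) Fin.≟ w (toℕ j)) notDistinct , distinct
    where
    distinct : ∀ a b → a < b → b < toℕ j → w a ≢ w b
    distinct a b a<b b<j = subst (λ t → w a ≢ w t) b′≡b
                                 (freshBelow b′ (earlierFresh (fromℕ< b<j)) a (subst (a <_) (sym b′≡b) a<b))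
      where
      b′ = inject (fromℕ< b<j)
      b′≡b : toℕ b′ ≡ b
      b′≡b = trans (toℕ-inject (fromℕ< b<j)) (toℕ-fromℕ< b<j)

open FirstRepetition using (firstRepetition)

-- If every vertex has an out-neighbour, the walk that keeps following them from a
-- vertex eventually closes a directed cycle: the stretch between the first
-- repeated vertex and its earlier occurrence.
module _ (G : Digraph) (next : Fin (n G) → Fin (n G)) (edge : ∀ u → Edge G u (next u)) where

  walkFrom : Fin (n G) → ℕ → Fin (n G)
  walkFrom start zero    = start
  walkFrom start (suc t) = next (walkFrom start t)

  successor⇒cycle : Fin (n G) → DirectedCycle G
  successor⇒cycle start with firstRepetition (walkFrom start)
  ... | i , j , i<j , repeat , distinct =
    closedWalk⇒cycle G walk (j ∸ i) (λ t → edge (walk t)) closed (m<n⇒0<n∸m i<j) distinct′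
    where
    walk : ℕ → Fin (n G)
    walk t = walkFrom start (t + i)
    j∸i+i≡j : j ∸ i + i ≡ j
    j∸i+i≡j = m∸n+n≡m (<⇒≤ i<j)
    closed : walk (j ∸ i) ≡ walk 0
    closed = trans (cong (walkFrom start) j∸i+i≡j) (sym repeat)
    distinct′ : ∀ a b → a < b → b < j ∸ i → walk a ≢ walk b
    distinct′ a b a<b b<j∸i =
      distinct (a + i) (b + i) (+-monoˡ-< i a<b) (subst (b + i <_) j∸i+i≡j (+-monoˡ-< i b<j∸i))

outNeighbour? : (G : Digraph) → ∀ u → Dec (∃ λ v → Edge G u v)
outNeighbour? G u = any? λ v → adj G u v Bool.≟ true

acyclic⇒sink : (G : Digraph) → IsDAG G → Fin (n G) → ∃ λ s → ∀ v → ¬ Edge G s v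
acyclic⇒sink G acyclic start with all? (outNeighbour? G)
... | yes allHaveOut =
  ⊥-elim (acyclic (successor⇒cycle G (proj₁ ∘ allHaveOut) (proj₂ ∘ allHaveOut) start))
... | no notAllHaveOut with ¬∀⟶∃¬ (n G) _ (outNeighbour? G) notAllHaveOut
...   | s , noOut = s , λ v e → noOut (v , e)

embedding-reflects-acyclic : (G H : Digraph) (f : Fin (n G) → Fin (n H)) →
                             Injective _≡_ _≡_ f → (∀ u v → Edge G u v → Edge H (f u) (f v)) →
                             IsDAG H → IsDAG G
embedding-reflects-acyclic G H f f-inj preserves acyclicH C = acyclicH record
  { k = k ; c = f ∘ c ; c-inj = c-inj ∘ f-inj
  ; step = λ t p → preserves _ _ (step t p) ; close = preserves _ _ close }
  where open DirectedCycle C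

Ascending : (G : Digraph) → Layout G → Set
Ascending G φ = ∀ u v → Edge G u v → pos G φ u < pos G φ v

Descending : (G : Digraph) → Layout G → Set
Descending G φ = ∀ u v → Edge G u v → pos G φ v < pos G φ u

pos-injective : (G : Digraph) (φ : Layout G) → ∀ {u v} → pos G φ u ≡ pos G φ v → u ≡ v
pos-injective G φ eq = Injection.injective (↔⇒↣ φ) (toℕ-injective (suc-injective eq))

reverseLayout : (G : Digraph) → Layout G → Layout G
reverseLayout G φ = φ ∘ₚ reverse

reverse-flips : (G : Digraph) (φ : Layout G) → ∀ {u v} →
                pos G φ u < pos G φ v → pos G (reverseLayout G φ) v < pos G (reverseLayout G φ) u
reverse-flips G φ {u} {v} u<v
  rewrite opposite-prop (Inverse.to φ u) | opposite-prop (Inverse.to φ v) =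
  s≤s (∸-monoʳ-< u<v (toℕ<n (Inverse.to φ v)))

ascending⇒acyclic : (G : Digraph) (φ : Layout G) → Ascending G φ → IsDAG G
ascending⇒acyclic G φ = potential⇒acyclic G (pos G φ)

descending⇒acyclic : (G : Digraph) (φ : Layout G) → Descending G φ → IsDAG G
descending⇒acyclic G φ descending =
  ascending⇒acyclic G (reverseLayout G φ) λ u v e → reverse-flips G φ (descending u v e)

digraph : (m : ℕ) (a : Fin m → Fin m → Bool) → (∀ u → a u u ≡ false) → Digraph
digraph m a noLoops = record { n = m ; adj = a ; loopless = noLoops }

deleteVertex : ∀ {m} (a : Fin (suc m) → Fin (suc m) → Bool) → (∀ u → a u u ≡ false) →
               Fin (suc m) → Digraph
deleteVertex {m} a noLoops s = digraph m (λ x y → a (punchIn s x) (punchIn s y)) (noLoops ∘ punchIn s)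

data DeletionView {m} (s : Fin (suc m)) : Fin (suc m) → Set where
  deleted  : DeletionView s s
  retained : ∀ x → DeletionView s (punchIn s x)

deletionView : ∀ {m} (s u : Fin (suc m)) → DeletionView s u
deletionView s u with s Fin.≟ u
... | yes refl = deleted
... | no  s≢u  = subst (DeletionView s) (punchIn-punchOut s≢u) (retained (punchOut s≢u))

-- insert i j π sends i to j (the library records only where it sends the other points).
insert-self : ∀ {m n} (i : Fin (suc m)) (j : Fin (suc n)) (π : Permutation m n) →
              insert i j π ⟨$⟩ʳ i ≡ j
insert-self i j π with i Fin.≟ i
... | yes _   = refl
... | no  i≢i = contradiction refl i≢i

-- Putting a sink s in front of a descending layout of the remaining vertices
-- yields a descending layout: edges into s now point to position 1, and the
-- other edges keep their relative order.
sinkFirst-descending :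
  ∀ {m} a noLoops (s : Fin (suc m)) → (∀ v → ¬ Edge (digraph (suc m) a noLoops) s v) →
  (φ : Layout (deleteVertex a noLoops s)) → Descending (deleteVertex a noLoops s) φ →
  Descending (digraph (suc m) a noLoops) (insert s 0F φ)
sinkFirst-descending a noLoops s sink φ descending u v e
  with deletionView s u | deletionView s v
... | deleted    | _          = ⊥-elim (sink v e)
... | retained x | deleted
  rewrite insert-punchIn s 0F φ x | insert-self s 0F φ = s≤s (s≤s z≤n)
... | retained x | retained y
  rewrite insert-punchIn s 0F φ x | insert-punchIn s 0F φ y = s≤s (descending x y e)

-- Every DAG has a descending layout (a reversed topological order): repeatedly
-- take a sink, lay out the rest recursively, and put the sink in front.
descendingLayout : ∀ m a noLoops → IsDAG (digraph m a noLoops) →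
                   Σ (Layout (digraph m a noLoops)) (Descending (digraph m a noLoops))
descendingLayout zero    a noLoops acyclic = Permutation.id , λ ()
descendingLayout (suc m) a noLoops acyclic with acyclic⇒sink (digraph (suc m) a noLoops) acyclic 0F
... | s , sink with descendingLayout m _ _ restAcyclic
  where
  restAcyclic : IsDAG (deleteVertex a noLoops s)
  restAcyclic = embedding-reflects-acyclic (deleteVertex a noLoops s) (digraph (suc m) a noLoops)
                  (punchIn s) (punchIn-injective s _ _) (λ _ _ e → e) acyclic
...   | φ , descending = insert s 0F φ , sinkFirst-descending a noLoops s sink φ descending

ascendingLayout : (G : Digraph) → IsDAG G → Σ (Layout G) (Ascending G)
ascendingLayout G acyclic with descendingLayout (n G) (adj G) (loopless G) acyclic
... | φ , descending = reverseLayout G φ , λ u v e → reverse-flips G φ (descending u v e)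

filterᵇ-length≤0⇔ : ∀ {A : Set} (p : A → Bool) (xs : List A) →
                    length (filterᵇ p xs) ≤ 0 ⇔ (∀ {x} → x ∈ xs → ¬ T (p x))
filterᵇ-length≤0⇔ p xs = mk⇔ nowhere empty
  where
  nowhere : length (filterᵇ p xs) ≤ 0 → ∀ {x} → x ∈ xs → ¬ T (p x)
  nowhere len≤0 x∈xs px = <⇒≱ (filter-some (T? ∘ p) (lose x∈xs px)) len≤0
  empty : (∀ {x} → x ∈ xs → ¬ T (p x)) → length (filterᵇ p xs) ≤ 0
  empty never = ≤-reflexive (cong length (filter-none (T? ∘ p) (All.tabulate never)))

pairs≡cartesianProduct : ∀ {A B : Set} (xs : List A) (ys : List B) →
                         concatMap (λ x → map (λ y → (x , y)) ys) xs ≡ cartesianProduct xs ys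
pairs≡cartesianProduct []       ys = refl
pairs≡cartesianProduct (x ∷ xs) ys = cong (map (x ,_) ys ++_) (pairs≡cartesianProduct xs ys)

T-not : ∀ {b} → T (not b) ⇔ (¬ T b)
T-not {true}  = mk⇔ (λ ()) (λ ¬t → ¬t _)
T-not {false} = mk⇔ (λ _ ()) (λ _ → _)

module _ (G : Digraph) (φ : Layout G) where

  inL⇔ : ∀ i u → T (inL G φ i u) ⇔ pos G φ u ≤ i
  inL⇔ i u = mk⇔ (λ t → s<s⁻¹ (<ᵇ⇒< _ _ t)) (λ u≤i → <⇒<ᵇ (s≤s u≤i))

  inR⇔ : ∀ i u → T (inR G φ i u) ⇔ i < pos G φ u
  inR⇔ i u = mk⇔ (λ t → ≰⇒> (to T-not t ∘ from (inL⇔ i u)))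
                 (λ i<u → from T-not (<⇒≱ i<u ∘ to (inL⇔ i u)))

  Crosses : ℕ → Fin (n G) → Fin (n G) → Set
  Crosses i u v = pos G φ u ≤ i × i < pos G φ v

  vsnAt≤0⇔ : ∀ i → vsnAt G φ i ≤ 0 ⇔ (∀ u v → Edge G v u → ¬ Crosses i u v)
  vsnAt≤0⇔ i = mk⇔ noBackEdge noSeparated
    where
    noBackEdge : vsnAt G φ i ≤ 0 → ∀ u v → Edge G v u → ¬ Crosses i u v
    noBackEdge isZero u v e (u≤i , i<v) =
      to (filterᵇ-length≤0⇔ _ (allFin (n G))) isZero (∈-allFin u)
        (from T-∧ (from (inL⇔ i u) u≤i ,
                   any⁺ _ (lose (∈-allFin v) (from T-∧ (from (inR⇔ i v) i<v , from T-≡ e)))))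
    noSeparated : (∀ u v → Edge G v u → ¬ Crosses i u v) → vsnAt G φ i ≤ 0
    noSeparated none = from (filterᵇ-length≤0⇔ _ (allFin (n G))) λ {u} _ separated →
      let (uL , someIn) = to T-∧ separated
          (v , vR∧e)    = satisfied (any⁻ _ (allFin (n G)) someIn)
          (vR , e)      = to T-∧ vR∧e
      in none u v (to T-≡ e) (to (inL⇔ i u) uL , to (inR⇔ i v) vR)

  cutAt≤0⇔ : ∀ i → cutAt G φ i ≤ 0 ⇔ (∀ u v → Edge G u v → ¬ Crosses i u v)
  cutAt≤0⇔ i = mk⇔ noForwardEdge noCrossingEdge
    where
    vertexPairs : List (Fin (n G) × Fin (n G))
    vertexPairs = concatMap (λ u → map (λ v → (u , v)) (allFin (n G))) (allFin (n G))
    ∈-vertexPairs : ∀ u v → (u , v) ∈ vertexPairs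
    ∈-vertexPairs u v = subst ((u , v) ∈_) (sym (pairs≡cartesianProduct (allFin (n G)) (allFin (n G))))
                              (∈-cartesianProduct⁺ (∈-allFin u) (∈-allFin v))
    noForwardEdge : cutAt G φ i ≤ 0 → ∀ u v → Edge G u v → ¬ Crosses i u v
    noForwardEdge isZero u v e (u≤i , i<v) =
      to (filterᵇ-length≤0⇔ _ vertexPairs) isZero (∈-vertexPairs u v)
        (from T-∧ (from (inL⇔ i u) u≤i , from T-∧ (from (inR⇔ i v) i<v , from T-≡ e)))
    noCrossingEdge : (∀ u v → Edge G u v → ¬ Crosses i u v) → cutAt G φ i ≤ 0
    noCrossingEdge none = from (filterᵇ-length≤0⇔ _ vertexPairs) λ {(u , v)} _ crossing →
      let (uL , vR∧e) = to T-∧ crossing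
          (vR , e)    = to T-∧ vR∧e
      in none u v (to T-≡ e) (to (inL⇔ i u) uL , to (inR⇔ i v) vR)

  AllCuts : (ℕ → Set) → Set
  AllCuts P = ∀ i → 1 ≤ i → i ≤ n G → P i

  -- For an irreflexive relation R on vertices: no R-related pair (u , v) has u
  -- left and v right of a cut exactly when R always points to an earlier position.
  -- (A pair pointing forward is separated by the cut right after its first vertex.)
  noCrossing⇔decreasing : (R : Fin (n G) → Fin (n G) → Set) → (∀ u → ¬ R u u) →
                          AllCuts (λ i → ∀ u v → R u v → ¬ Crosses i u v) ⇔
                          (∀ u v → R u v → pos G φ v < pos G φ u)
  noCrossing⇔decreasing R irreflexive = mk⇔ decreasing noCrossing
    where
    decreasing : AllCuts (λ i → ∀ u v → R u v → ¬ Crosses i u v) →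
                 ∀ u v → R u v → pos G φ v < pos G φ u
    decreasing none u v r with <-cmp (pos G φ u) (pos G φ v)
    ... | tri< u<v _ _ = ⊥-elim (none (pos G φ u) (s≤s z≤n) (toℕ<n (Inverse.to φ u)) u v r (≤-refl , u<v))
    ... | tri≈ _ u≡v _ = ⊥-elim (irreflexive v (subst (λ w → R w v) (pos-injective G φ u≡v) r))
    ... | tri> _ _ v<u = v<u
    noCrossing : (∀ u v → R u v → pos G φ v < pos G φ u) →
                 AllCuts (λ i → ∀ u v → R u v → ¬ Crosses i u v)
    noCrossing backwards i _ _ u v r (u≤i , i<v) =
      <-irrefl refl (<-trans (<-≤-trans (backwards u v r) u≤i) i<v)

  vsnZero⇔ascending : AllCuts (λ i → vsnAt G φ i ≤ 0) ⇔ Ascending G φ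
  vsnZero⇔ascending = mk⇔
    (λ vsnZero u v e → to reversedEdges (λ i 1≤i i≤n → to (vsnAt≤0⇔ i) (vsnZero i 1≤i i≤n)) v u e)
    (λ ascending i 1≤i i≤n → from (vsnAt≤0⇔ i) (from reversedEdges (λ u v e → ascending v u e) i 1≤i i≤n))
    where
    reversedEdges : AllCuts (λ i → ∀ u v → Edge G v u → ¬ Crosses i u v) ⇔
                    (∀ u v → Edge G v u → pos G φ v < pos G φ u)
    reversedEdges = noCrossing⇔decreasing (λ u v → Edge G v u) (noLoop G)

  cutZero⇔descending : AllCuts (λ i → cutAt G φ i ≤ 0) ⇔ Descending G φ
  cutZero⇔descending = mk⇔
    (λ cutZero → to forwardEdges (λ i 1≤i i≤n → to (cutAt≤0⇔ i) (cutZero i 1≤i i≤n)))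
    (λ descending i 1≤i i≤n → from (cutAt≤0⇔ i) (from forwardEdges descending i 1≤i i≤n))
    where
    forwardEdges : AllCuts (λ i → ∀ u v → Edge G u v → ¬ Crosses i u v) ⇔ Descending G φ
    forwardEdges = noCrossing⇔decreasing (Edge G) (noLoop G)

atMostOne : ∀ {m} {p : Subset m} {x y} → ∣ p ∣ ≤ 1 → x ∈ₛ p → y ∈ₛ p → x ≡ y
atMostOne {p = p} {x} {y} size≤1 x∈p y∈p with x Fin.≟ y
... | yes x≡y = x≡y
... | no  x≢y = contradiction (<-≤-trans (≤-<-trans y∈rest (x∈p⇒∣p-x∣<∣p∣ x∈p)) size≤1) (<-irrefl refl)
  where
  y∈rest : 1 ≤ ∣ p - x ∣
  y∈rest = subst (_≤ ∣ p - x ∣) (∣⁅x⁆∣≡1 y) (p⊆q⇒∣p∣≤∣q∣ λ {z} z∈⁅y⁆ →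
             subst (_∈ₛ p - x) (sym (x∈⁅y⁆⇒x≡y y z∈⁅y⁆)) (x∈p∧x≢y⇒x∈p-y y∈p (x≢y ∘ sym)))

module _ (G : Digraph) where

  ascending⇒widthZero : (φ : Layout G) → Ascending G φ → DPwAtMost G 0
  ascending⇒widthZero φ ascending = decomposition , λ i → ≤-reflexive (∣⁅x⁆∣≡1 (Inverse.from φ i))
    where
    X : Fin (n G) → Subset (n G)
    X i = ⁅ Inverse.from φ i ⁆
    inOwnBag : ∀ u → u ∈ₛ X (Inverse.to φ u)
    inOwnBag u = subst (λ w → u ∈ₛ ⁅ w ⁆) (sym (Inverse.strictlyInverseʳ φ u)) (x∈⁅x⁆ u)
    -- distinct bags are disjoint, so no vertex has to be carried across a bag
    disjoint : ∀ i l {x} → x ∈ₛ X i ∩ X l → i ≡ l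
    disjoint i l x∈both = begin
      i                              ≡⟨ Inverse.strictlyInverseˡ φ i ⟨
      Inverse.to φ (Inverse.from φ i) ≡⟨ cong (Inverse.to φ) (trans (sym (x∈⁅y⁆⇒x≡y _ x∈Xi)) (x∈⁅y⁆⇒x≡y _ x∈Xl)) ⟩
      Inverse.to φ (Inverse.from φ l) ≡⟨ Inverse.strictlyInverseˡ φ l ⟩
      l                              ∎
      where
      open ≡-Reasoning
      x∈Xi = proj₁ (x∈p∩q⁻ (X i) (X l) x∈both)
      x∈Xl = proj₂ (x∈p∩q⁻ (X i) (X l) x∈both)
    decomposition : DirPathDecomposition G
    decomposition = record
      { r      = n G
      ; X      = X
      ; cover  = λ u → Inverse.to φ u , inOwnBag u
      ; edges  = λ u v e → Inverse.to φ u , Inverse.to φ v , <⇒≤ (s<s⁻¹ (ascending u v e)) , inOwnBag u , inOwnBag v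
      ; interp = λ i j l i<j j<l x∈both →
                   ⊥-elim (<-irrefl (cong toℕ (disjoint i l x∈both)) (<-trans i<j j<l))
      }

  -- In a decomposition of width 0 each bag holds at most one vertex, so by the
  -- interpolation property the bags of two distinct vertices form disjoint
  -- intervals; an edge u → v places the interval of u before that of v, and the
  -- index of a bag containing a vertex is a potential increasing along edges.
  widthZero⇒acyclic : DPwAtMost G 0 → IsDAG G
  widthZero⇒acyclic (D , width0) = potential⇒acyclic G (λ u → toℕ (proj₁ (cover u))) bagIndex-increasing
    where
    open DirPathDecomposition D
    sameBag : ∀ {a u v} → u ∈ₛ X a → v ∈ₛ X a → u ≡ v
    sameBag = atMostOne (width0 _)
    occurrencesOrdered : ∀ {u v i j a b} → u ≢ v → u ∈ₛ X i → v ∈ₛ X j → i Fin.< j →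
                         u ∈ₛ X a → v ∈ₛ X b → a Fin.< b
    occurrencesOrdered {a = a} {b} u≢v ui vj i<j ua vb with Finₚ.<-cmp a b
    ... | tri< a<b _ _  = a<b
    ... | tri≈ _ refl _ = ⊥-elim (u≢v (sameBag ua vb))
    ... | tri> _ _ b<a with Finₚ.<-cmp a _
    ...   | tri< a<j _ _  = ⊥-elim (u≢v (sameBag ua (interp _ _ _ b<a a<j (x∈p∩q⁺ (vb , vj)))))
    ...   | tri≈ _ refl _ = ⊥-elim (u≢v (sameBag ua vj))
    ...   | tri> _ _ j<a  = ⊥-elim (u≢v (sameBag (interp _ _ _ i<j j<a (x∈p∩q⁺ (ui , ua))) vj))
    bagIndex-increasing : ∀ u v → Edge G u v → toℕ (proj₁ (cover u)) < toℕ (proj₁ (cover v))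
    bagIndex-increasing u v e with edges u v e
    ... | i , j , i≤j , ui , vj = occurrencesOrdered u≢v ui vj i<j (proj₂ (cover u)) (proj₂ (cover v))
      where
      u≢v : u ≢ v
      u≢v u≡v = noLoop G v (subst (λ w → Edge G w v) u≡v e)
      i<j : i Fin.< j
      i<j = ≤∧≢⇒< i≤j λ i≡j → u≢v (sameBag ui (subst (λ k → v ∈ₛ X k) (sym (toℕ-injective i≡j)) vj))

-- In each of the three characterisations below, minimality of the width 0 is
-- automatic (λ _ _ → z≤n) since widths are natural numbers.

dag⇔vsnZero : (G : Digraph) → IsDAG G ⇔ DVsnIs G 0
dag⇔vsnZero G = mk⇔
  (λ acyclic → let (φ , ascending) = ascendingLayout G acyclic
               in (φ , from (vsnZero⇔ascending G φ) ascending) , λ _ _ → z≤n)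
  (λ ((φ , vsnZero) , _) → ascending⇒acyclic G φ (to (vsnZero⇔ascending G φ) vsnZero))

dag⇔pwZero : (G : Digraph) → IsDAG G ⇔ DPwIs G 0
dag⇔pwZero G = mk⇔
  (λ acyclic → let (φ , ascending) = ascendingLayout G acyclic
               in ascending⇒widthZero G φ ascending , λ _ _ → z≤n)
  (λ (widthZero , _) → widthZero⇒acyclic G widthZero)

dag⇔cutwZero : (G : Digraph) → IsDAG G ⇔ DCutwIs G 0
dag⇔cutwZero G = mk⇔
  (λ acyclic → let (φ , descending) = descendingLayout (n G) (adj G) (loopless G) acyclic
               in (φ , from (cutZero⇔descending G φ) descending) , λ _ _ → z≤n)
  (λ ((φ , cutZero) , _) → descending⇒acyclic G φ (to (cutZero⇔descending G φ) cutZero))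

theorem6p1 : (G : Digraph) →
    (IsDAG G ⇔ DVsnIs G 0) × (IsDAG G ⇔ DPwIs G 0) × (IsDAG G ⇔ DCutwIs G 0)
theorem6p1 G = dag⇔vsnZero G , dag⇔pwZero G , dag⇔cutwZero G
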